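{- Let $G$ be a subcubic graph, $\pi=\{V_1,\dots,V_k\}$ a connected coalition partition of $G$, and $H=CCG(G,\pi)$. Then $\alpha(H)\le 3$. If $\alpha(H)=3$, then either (i) $G\cong H\cong M_6\cong K_{3,3}$, or (ii) $G\cong Pr_6$ and $H\cong 3K_2$.
   Context: Graphs are finite and simple. A graph is subcubic if it is connected and its maximum vertex degree is at most 3. $G[S]$ is the induced subgraph. A set $D\subseteq V$ is dominating if every vertex of $V\setminus D$ has a neighbour in $D$; connected dominating if moreover $G[D]$ is connected. Two disjoint subsets $A,B\subseteq V$ form a connected coalition if neither is a connected dominating set but $A\cup B$ is. A connected coalition partition of $G$ is a partition $\pi=\{V_1,\dots,V_k\}$ of $V$ such that each $V_i$ either is a connected dominating set consisting of a single vertex or forms a connected coalition with some set of $\pi$. The coalition graph $CCG(G,\pi)$ has vertex set $\{V_1,\dots,V_k\}$, with $V_i\sim V_j$ iff they form a connected coalition. $\alpha(H)$ denotes the maximum size of a matching in $H$. $Pr_6$ is the triangular prism $C_3\times K_2$; $M_6$ is the Möbius ladder on 6 vertices ($C_6$ plus the three edges joining opposite vertices), isomorphic to $K_{3,3}$; $3K_2$ is three disjoint edges. -}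

module Defs where

open import Level using (0ℓ)
open import Data.Nat using (ℕ; _%_; _+_; _≤_)
open import Data.Fin using (Fin; toℕ)
open import Data.Product using (Σ; _×_; _,_; ∃)
open import Data.Sum using (_⊎_; [_,_]′)
open import Data.Unit using (⊤)
open import Data.Empty using (⊥)
open import Relation.Nullary using (¬_)
open import Relation.Binary.PropositionalEquality using (_≡_; _≢_)
open import Function using (_⇔_)
open import Function.Definitions using (Injective)

Rel : Set → Set₁
Rel V = V → V → Set

IsSimple : {V : Set} → Rel V → Set
IsSimple {V} E = (∀ u v → E u v → E v u) × (∀ v → ¬ E v v)

Subset : Set → Set₁
Subset V = V → Set

_∪_ : {V : Set} → Subset V → Subset V → Subset V
(A ∪ B) v = A v ⊎ B v

data WalkIn {V : Set} (E : Rel V) (S : Subset V) : V → V → Set where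
  here : ∀ {u} → S u → WalkIn E S u u
  step : ∀ {u w v} → S u → E u w → WalkIn E S w v → WalkIn E S u v

InducedConnected : {V : Set} → Rel V → Subset V → Set
InducedConnected E S = ∀ u v → S u → S v → WalkIn E S u v

Connected : {V : Set} → Rel V → Set
Connected E = ∀ u v → WalkIn E (λ _ → ⊤) u v

MaxDeg≤3 : {n : ℕ} → Rel (Fin n) → Set
MaxDeg≤3 {n} E = ∀ (v : Fin n) (f : Fin 4 → Fin n) →
  Injective _≡_ _≡_ f → (∀ i → E v (f i)) → ⊥

Subcubic : {n : ℕ} → Rel (Fin n) → Set
Subcubic E = IsSimple E × Connected E × MaxDeg≤3 E

Dominating : {V : Set} → Rel V → Subset V → Set
Dominating {V} E D = ∀ (v : V) → ¬ D v → Σ V λ u → D u × E v u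

ConnectedDominating : {V : Set} → Rel V → Subset V → Set
ConnectedDominating E D = Dominating E D × InducedConnected E D

ConnCoalition : {V : Set} → Rel V → Subset V → Subset V → Set
ConnCoalition {V} E A B =
  (∀ (v : V) → A v → B v → ⊥) ×
  ¬ ConnectedDominating E A ×
  ¬ ConnectedDominating E B ×
  ConnectedDominating E (A ∪ B)

-- A partition of Fin n into k (nonempty) classes: a surjection onto Fin k;
-- class i is the preimage of i.
Class : {n k : ℕ} → (Fin n → Fin k) → Fin k → Subset (Fin n)
Class p i v = p v ≡ i

IsPartition : {n k : ℕ} → (Fin n → Fin k) → Set
IsPartition {n} {k} p = ∀ (i : Fin k) → Σ (Fin n) λ v → p v ≡ i

Singleton : {V : Set} → Subset V → Set
Singleton {V} S = Σ V λ v → ∀ u → (S u ⇔ (u ≡ v))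

IsConnCoalitionPartition : {n k : ℕ} → Rel (Fin n) → (Fin n → Fin k) → Set
IsConnCoalitionPartition {n} {k} E p =
  IsPartition p ×
  (∀ (i : Fin k) →
     (Singleton (Class p i) × ConnectedDominating E (Class p i))
     ⊎ (Σ (Fin k) λ j → ConnCoalition E (Class p i) (Class p j)))

CCG : {n k : ℕ} → Rel (Fin n) → (Fin n → Fin k) → Rel (Fin k)
CCG E p i j = ConnCoalition E (Class p i) (Class p j)

Matching : {V : Set} → Rel V → ℕ → Set
Matching {V} E m = Σ (Fin m → V) λ a → Σ (Fin m → V) λ b →
  (∀ i → E (a i) (b i)) × Injective _≡_ _≡_ [ a , b ]′

-- α(H) ≤ c
MatchingNumber≤ : {V : Set} → Rel V → ℕ → Set
MatchingNumber≤ E c = ∀ m → Matching E m → m ≤ c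

MatchingNumber≡ : {V : Set} → Rel V → ℕ → Set
MatchingNumber≡ E c = Matching E c × MatchingNumber≤ E c

record Iso {V W : Set} (E : Rel V) (F : Rel W) : Set where
  field
    to      : V → W
    from    : W → V
    from-to : ∀ v → from (to v) ≡ v
    to-from : ∀ w → to (from w) ≡ w
    adj⇔    : ∀ u v → E u v ⇔ F (to u) (to v)

-- M₆: the Möbius ladder, C₆ on 0..5 plus the three edges joining opposite vertices
M6 : Rel (Fin 6)
M6 i j = (toℕ j ≡ (toℕ i + 1) % 6) ⊎ (toℕ i ≡ (toℕ j + 1) % 6) ⊎ (toℕ j ≡ (toℕ i + 3) % 6)

-- K₃,₃ with parts Fin 3 × {0} and Fin 3 × {1}
K33 : Rel (Fin 3 × Fin 2)
K33 (a , x) (b , y) = x ≢ y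

-- Pr₆ = C₃ × K₂ (Cartesian product)
Pr6 : Rel (Fin 3 × Fin 2)
Pr6 (a , x) (b , y) = (x ≡ y × a ≢ b) ⊎ (a ≡ b × x ≢ y)

ThreeK2 : Rel (Fin 3 × Fin 2)
ThreeK2 (a , x) (b , y) = a ≡ b × x ≢ y

-- If a i — b i (i < m) is a matching of the coalition graph, the sets D i = V (a i) ∪ V (b i) are
-- pairwise disjoint connected dominating sets with at least two vertices each.  A vertex of one of
-- them has a neighbour in every D i, so subcubicity forces m ≤ 3.  When m = 3 every vertex has
-- exactly one neighbour in each D j: each D i is then a single edge, the D i cover the graph, every
-- class of the partition is a singleton, and any two of the three edges are joined by a perfect
-- matching, straight or crossed.  Going once around the three matchings is either the identity,
-- and G is the prism Pr6, or a swap, and G is K33.  Two singletons form a connected coalition iff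
-- they span an edge lying in no triangle; in Pr6 these are the three rungs (3K2), in K33 all edges.

{-# OPTIONS --safe #-}
module Submission where

open import Defs
import Data.Bool.Properties as Bool
open import Data.Empty using (⊥; ⊥-elim)
open import Data.Fin using (Fin; zero; suc; #_; toℕ; inject≤; punchIn; remQuot; combine)
open import Data.Fin.Properties
  using (_≟_; all?; any?; 0≢1+n; inject≤-injective; punchInᵢ≢i; punchIn-injective;
         remQuot-combine; combine-remQuot)
open import Data.Nat using (ℕ; zero; suc; _+_; _%_; _≤_; _≤?_; z≤n)
import Data.Nat as ℕ
open import Data.Nat.Properties using (≰⇒>)
open import Data.Product using (Σ; ∃; _×_; _,_; proj₁; proj₂; uncurry)
open import Data.Product.Function.NonDependent.Propositional using (_×-⇔_)
open import Data.Product.Properties using (≡-dec)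
open import Data.Sum using (_⊎_; inj₁; inj₂; [_,_]′)
open import Data.Sum.Properties using (inj₁-injective; inj₂-injective)
import Data.Sum as Sum
open import Data.Sum.Function.Propositional using (_⊎-⇔_)
open import Data.Vec using (Vec; []; _∷_; lookup)
open import Data.Vec.Relation.Unary.All using (All; []; _∷_)
open import Data.Vec.Relation.Unary.All.Properties using (lookup⁺)
open import Data.Vec.Relation.Unary.AllPairs using ([]; _∷_)
open import Data.Vec.Relation.Unary.Unique.Propositional using (Unique)
open import Data.Vec.Relation.Unary.Unique.Propositional.Properties using (lookup-injective)
open import Function using (_∘_)
open import Function.Bundles using (_⇔_; mk⇔; Equivalence)
open import Function.Construct.Composition using (_⇔-∘_)
open import Function.Construct.Symmetry using (⇔-sym)
open import Function.Definitions using (Injective)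
open import Function.Related.TypeIsomorphisms using (¬-cong-⇔)
open import Relation.Binary.PropositionalEquality using (_≡_; _≢_; refl; sym; trans; cong; subst; subst₂)
open import Relation.Binary.Definitions using (DecidableEquality)
open import Relation.Nullary using (¬_; Dec; yes; no; does)
open import Relation.Nullary.Decidable using (map′; from-yes; _×-dec_; _⊎-dec_; ¬?)

open Equivalence using () renaming (to to forth; from to back)

Iso-sym : {V W : Set} {E : Rel V} {F : Rel W} → Iso E F → Iso F E
Iso-sym {E = E} {F} I = record
  { to = from ; from = to ; from-to = to-from ; to-from = from-to
  ; adj⇔ = λ u v → subst₂ (λ u' v' → F u' v' ⇔ E (from u) (from v)) (to-from u) (to-from v)
                     (⇔-sym (adj⇔ (from u) (from v))) }
  where open Iso I

Iso-trans : {U V W : Set} {E : Rel U} {F : Rel V} {G : Rel W} → Iso E F → Iso F G → Iso E G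
Iso-trans I J = record
  { to = J.to ∘ I.to ; from = I.from ∘ J.from
  ; from-to = λ u → trans (cong I.from (J.from-to (I.to u))) (I.from-to u)
  ; to-from = λ w → trans (cong J.to (I.to-from (J.from w))) (J.to-from w)
  ; adj⇔ = λ u v → J.adj⇔ (I.to u) (I.to v) ⇔-∘ I.adj⇔ u v }
  where
  module I = Iso I
  module J = Iso J

Iso-reflexive : {V : Set} {E F : Rel V} → (∀ u v → E u v ⇔ F u v) → Iso E F
Iso-reflexive E⇔F = record
  { to = λ v → v ; from = λ v → v ; from-to = λ _ → refl ; to-from = λ _ → refl ; adj⇔ = E⇔F }

NeighbourIn : {V : Set} → Rel V → Subset V → V → Set
NeighbourIn {V} E S u = Σ V λ w → S w × E u w

InducedMaxDeg≤1 : {V : Set} → Rel V → Subset V → Set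
InducedMaxDeg≤1 E S = ∀ {u w w'} → S u → S w → S w' → E u w → E u w' → w ≡ w'

module _ {V : Set} {E : Rel V} {S : Subset V} where

  walk-head : ∀ {u v} → WalkIn E S u v → S u
  walk-head (here Su) = Su
  walk-head (step Su _ _) = Su

  walk-leaves : ∀ {u v} → WalkIn E S u v → u ≢ v → NeighbourIn E S u
  walk-leaves (here _) u≢u = ⊥-elim (u≢u refl)
  walk-leaves (step _ uw rest) _ = _ , walk-head rest , uw

  module _ (E-sym : ∀ {u v} → E u v → E v u) (deg≤1 : InducedMaxDeg≤1 E S)
           {u w : V} (Su : S u) (Sw : S w) (uw : E u w) where

    walk-stays-on-edge : ∀ {a b} → WalkIn E S a b → a ≡ u ⊎ a ≡ w → b ≡ u ⊎ b ≡ w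
    walk-stays-on-edge (here _) a-on-edge = a-on-edge
    walk-stays-on-edge (step Su' uw' rest) (inj₁ refl) =
      walk-stays-on-edge rest (inj₂ (deg≤1 Su' (walk-head rest) Sw uw' uw))
    walk-stays-on-edge (step Sw' wu' rest) (inj₂ refl) =
      walk-stays-on-edge rest (inj₁ (deg≤1 Sw' (walk-head rest) Su wu' (E-sym uw)))

    connected-set-is-edge : InducedConnected E S → ∀ {v} → S v → v ≡ u ⊎ v ≡ w
    connected-set-is-edge connected Sv = walk-stays-on-edge (connected _ _ Su Sv) (inj₁ refl)

-- Connected coalitions of two singletons

ClosedNeighbourhood : {V : Set} → Rel V → V → Subset V
ClosedNeighbourhood E w q = q ≡ w ⊎ E q w

SingletonCoalition : {V : Set} → Rel V → Rel V
SingletonCoalition {V} E w w' =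
  E w w' × (∀ q → N w q ⊎ N w' q) × ¬ (∀ q → N w q) × ¬ (∀ q → N w' q)
  where
  N : V → Subset V
  N = ClosedNeighbourhood E

module _ {V : Set} {E : Rel V} (simple : IsSimple E) (_≟ᵥ_ : DecidableEquality V) where

  private
    N : V → Subset V
    N = ClosedNeighbourhood E

    E-irrefl : ∀ {v} → ¬ E v v
    E-irrefl = proj₂ simple _

  singleton-cds : ∀ {A w} → (∀ u → A u ⇔ u ≡ w) → ConnectedDominating E A ⇔ (∀ q → N w q)
  singleton-cds {A} {w} A≐w =
    mk⇔ (λ (dominating , _) → closed dominating) (λ all-close → dominating all-close , connected)
    where
    closed : Dominating E A → ∀ q → N w q
    closed dominating q with q ≟ᵥ w
    ... | yes q≡w = inj₁ q≡w
    ... | no q≢w with dominating q (q≢w ∘ forth (A≐w q))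
    ...   | u , Au , qu = inj₂ (subst (E q) (forth (A≐w u) Au) qu)
    dominating : (∀ q → N w q) → Dominating E A
    dominating all-close v ¬Av with all-close v
    ... | inj₁ v≡w = ⊥-elim (¬Av (back (A≐w v) v≡w))
    ... | inj₂ vw = w , back (A≐w w) refl , vw
    connected : InducedConnected E A
    connected u v Au Av = subst (WalkIn E A u) (trans (forth (A≐w u) Au) (sym (forth (A≐w v) Av))) (here Au)

  module _ {A B : Subset V} {w w' : V}
           (A≐w : ∀ u → A u ⇔ u ≡ w) (B≐w' : ∀ u → B u ⇔ u ≡ w') where

    private
      Aw : A w
      Aw = back (A≐w w) refl

      Bw' : B w'
      Bw' = back (B≐w' w') refl

      one-of-two : ∀ {u} → (A ∪ B) u → u ≡ w ⊎ u ≡ w'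
      one-of-two = Sum.map (forth (A≐w _)) (forth (B≐w' _))

    pair-dominating : Dominating E (A ∪ B) ⇔ (∀ q → N w q ⊎ N w' q)
    pair-dominating = mk⇔ closed dominating
      where
      closed : Dominating E (A ∪ B) → ∀ q → N w q ⊎ N w' q
      closed dominating q with q ≟ᵥ w | q ≟ᵥ w'
      ... | yes q≡w | _ = inj₁ (inj₁ q≡w)
      ... | no _ | yes q≡w' = inj₂ (inj₁ q≡w')
      ... | no q≢w | no q≢w' with dominating q [ q≢w ∘ forth (A≐w q) , q≢w' ∘ forth (B≐w' q) ]′
      ...   | u , ABu , qu =
        Sum.map (λ u≡w → inj₂ (subst (E q) u≡w qu)) (λ u≡w' → inj₂ (subst (E q) u≡w' qu)) (one-of-two ABu)
      dominating : (∀ q → N w q ⊎ N w' q) → Dominating E (A ∪ B)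
      dominating all-close v ¬ABv with all-close v
      ... | inj₁ (inj₁ v≡w) = ⊥-elim (¬ABv (inj₁ (back (A≐w v) v≡w)))
      ... | inj₁ (inj₂ vw) = w , inj₁ Aw , vw
      ... | inj₂ (inj₁ v≡w') = ⊥-elim (¬ABv (inj₂ (back (B≐w' v) v≡w')))
      ... | inj₂ (inj₂ vw') = w' , inj₂ Bw' , vw'

    pair-connected : w ≢ w' → InducedConnected E (A ∪ B) ⇔ E w w'
    pair-connected w≢w' = mk⇔ adjacent connected
      where
      adjacent : InducedConnected E (A ∪ B) → E w w'
      adjacent connected with walk-leaves (connected w w' (inj₁ Aw) (inj₂ Bw')) w≢w'
      ... | u , ABu , wu with one-of-two ABu
      ...   | inj₁ u≡w = ⊥-elim (E-irrefl (subst (E w) u≡w wu))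
      ...   | inj₂ u≡w' = subst (E w) u≡w' wu
      walk : E w w' → ∀ {u v} → u ≡ w ⊎ u ≡ w' → v ≡ w ⊎ v ≡ w' → WalkIn E (A ∪ B) u v
      walk _ (inj₁ refl) (inj₁ refl) = here (inj₁ Aw)
      walk ww' (inj₁ refl) (inj₂ refl) = step (inj₁ Aw) ww' (here (inj₂ Bw'))
      walk ww' (inj₂ refl) (inj₁ refl) = step (inj₂ Bw') (proj₁ simple _ _ ww') (here (inj₁ Aw))
      walk _ (inj₂ refl) (inj₂ refl) = here (inj₂ Bw')
      connected : E w w' → InducedConnected E (A ∪ B)
      connected ww' u v ABu ABv = walk ww' (one-of-two ABu) (one-of-two ABv)

    singleton-coalition : ConnCoalition E A B ⇔ SingletonCoalition E w w'
    singleton-coalition = mk⇔ forwards backwards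
      where
      forwards : ConnCoalition E A B → SingletonCoalition E w w'
      forwards (disjoint , ¬cdsA , ¬cdsB , dominating , connected) =
        forth (pair-connected w≢w') connected , forth pair-dominating dominating ,
        ¬cdsA ∘ back (singleton-cds A≐w) , ¬cdsB ∘ back (singleton-cds B≐w')
        where
        w≢w' : w ≢ w'
        w≢w' w≡w' = disjoint w Aw (back (B≐w' w) w≡w')
      backwards : SingletonCoalition E w w' → ConnCoalition E A B
      backwards (ww' , all-close , ¬all-closeA , ¬all-closeB) =
        (λ v Av Bv → w≢w' (trans (sym (forth (A≐w v) Av)) (forth (B≐w' v) Bv))) ,
        ¬all-closeA ∘ forth (singleton-cds A≐w) , ¬all-closeB ∘ forth (singleton-cds B≐w') ,
        back pair-dominating all-close , back (pair-connected w≢w') ww'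
        where
        w≢w' : w ≢ w'
        w≢w' w≡w' = E-irrefl (subst (E w) (sym w≡w') ww')

Iso-SingletonCoalition : {V W : Set} {F : Rel V} {E : Rel W} →
                         Iso F E → Iso (SingletonCoalition F) (SingletonCoalition E)
Iso-SingletonCoalition {V} {W} {F} {E} I = record
  { to = to ; from = from ; from-to = from-to ; to-from = to-from
  ; adj⇔ = λ u v → adj⇔ u v
                   ×-⇔ ∀-along-iso (λ q → closed u q ⊎-⇔ closed v q)
                   ×-⇔ ¬-cong-⇔ (∀-along-iso (closed u))
                   ×-⇔ ¬-cong-⇔ (∀-along-iso (closed v)) }
  where
  open Iso I
  closed : ∀ u q → ClosedNeighbourhood F u q ⇔ ClosedNeighbourhood E (to u) (to q)
  closed u q = mk⇔ (cong to) (λ eq → trans (sym (from-to q)) (trans (cong from eq) (from-to u)))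
               ⊎-⇔ adj⇔ q u
  ∀-along-iso : {P : V → Set} {Q : W → Set} → (∀ q → P q ⇔ Q (to q)) → (∀ q → P q) ⇔ (∀ w → Q w)
  ∀-along-iso {Q = Q} P⇔Q =
    mk⇔ (λ h w → subst Q (to-from w) (forth (P⇔Q (from w)) (h (from w)))) (λ h q → back (P⇔Q q) (h (to q)))

module _ {n : ℕ} {E : Rel (Fin n)} (maxDeg : MaxDeg≤3 E) where

  no-four-distinct-neighbours : ∀ {u} (ws : Vec (Fin n) 4) → Unique ws → All (E u) ws → ⊥
  no-four-distinct-neighbours ws distinct adjacent =
    maxDeg _ (lookup ws) (lookup-injective distinct _ _) (lookup⁺ adjacent)

  injective-neighbour-family≤3 : ∀ {m u} (w : Fin m → Fin n) → Injective _≡_ _≡_ w →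
                                (∀ i → E u (w i)) → m ≤ 3
  injective-neighbour-family≤3 {m} w w-injective adjacent with m ≤? 3
  ... | yes m≤3 = m≤3
  ... | no m≰3 =
    ⊥-elim (maxDeg _ (w ∘ ι) (λ {i} {j} → inject≤-injective 4≤m 4≤m i j ∘ w-injective) (adjacent ∘ ι))
    where
    4≤m : 4 ≤ m
    4≤m = ≰⇒> m≰3
    ι : Fin 4 → Fin m
    ι i = inject≤ i 4≤m

-- The six-vertex graphs

Six : Set
Six = Fin 3 × Fin 2

module PerfectMatching₂ {B : Fin 2 → Fin 2 → Set}
  (total : ∀ σ → ∃ (B σ))
  (functional : ∀ σ τ τ' → B σ τ → B σ τ' → τ ≡ τ')
  (injective : ∀ σ σ' τ → B σ τ → B σ' τ → σ ≡ σ') where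

  straight : B zero zero → ∀ σ τ → B σ τ ⇔ σ ≡ τ
  straight b₀₀ zero zero = mk⇔ (λ _ → refl) (λ _ → b₀₀)
  straight b₀₀ zero (suc zero) = mk⇔ (functional _ _ _ b₀₀) (λ ())
  straight b₀₀ (suc zero) zero = mk⇔ (λ b₁₀ → injective _ _ _ b₁₀ b₀₀) (λ ())
  straight b₀₀ (suc zero) (suc zero) = mk⇔ (λ _ → refl) (λ _ → b₁₁ (total (suc zero)))
    where
    b₁₁ : ∃ (B (suc zero)) → B (suc zero) (suc zero)
    b₁₁ (zero , b₁₀) = ⊥-elim (0≢1+n (sym (injective _ _ _ b₁₀ b₀₀)))
    b₁₁ (suc zero , b) = b

  crossed : B zero (suc zero) → ∀ σ τ → B σ τ ⇔ σ ≢ τ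
  crossed b₀₁ zero zero =
    mk⇔ (λ b₀₀ _ → 0≢1+n (functional _ _ _ b₀₀ b₀₁)) (λ 0≢0 → ⊥-elim (0≢0 refl))
  crossed b₀₁ zero (suc zero) = mk⇔ (λ _ ()) (λ _ → b₀₁)
  crossed b₀₁ (suc zero) zero = mk⇔ (λ _ ()) (λ _ → b₁₀ (total (suc zero)))
    where
    b₁₀ : ∃ (B (suc zero)) → B (suc zero) zero
    b₁₀ (zero , b) = b
    b₁₀ (suc zero , b₁₁) = ⊥-elim (0≢1+n (sym (injective _ _ _ b₁₁ b₀₁)))
  crossed b₀₁ (suc zero) (suc zero) =
    mk⇔ (λ b₁₁ _ → 0≢1+n (sym (injective _ _ _ b₁₁ b₀₁))) (λ 1≢1 → ⊥-elim (1≢1 refl))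

off-diagonal-pairs : {R : Fin 3 → Fin 3 → Set} → (∀ {i j} → R i j → R j i) →
                     R (# 0) (# 1) → R (# 0) (# 2) → R (# 1) (# 2) → ∀ i j → i ≢ j → R i j
off-diagonal-pairs R-sym r₀₁ r₀₂ r₁₂ zero zero i≢j = ⊥-elim (i≢j refl)
off-diagonal-pairs R-sym r₀₁ r₀₂ r₁₂ zero (suc zero) _ = r₀₁
off-diagonal-pairs R-sym r₀₁ r₀₂ r₁₂ zero (suc (suc zero)) _ = r₀₂
off-diagonal-pairs R-sym r₀₁ r₀₂ r₁₂ (suc zero) zero _ = R-sym r₀₁
off-diagonal-pairs R-sym r₀₁ r₀₂ r₁₂ (suc zero) (suc zero) i≢j = ⊥-elim (i≢j refl)
off-diagonal-pairs R-sym r₀₁ r₀₂ r₁₂ (suc zero) (suc (suc zero)) _ = r₁₂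
off-diagonal-pairs R-sym r₀₁ r₀₂ r₁₂ (suc (suc zero)) zero _ = R-sym r₀₂
off-diagonal-pairs R-sym r₀₁ r₀₂ r₁₂ (suc (suc zero)) (suc zero) _ = R-sym r₁₂
off-diagonal-pairs R-sym r₀₁ r₀₂ r₁₂ (suc (suc zero)) (suc (suc zero)) i≢j = ⊥-elim (i≢j refl)

Pr6-within : ∀ {i σ τ} → Pr6 (i , σ) (i , τ) ⇔ σ ≢ τ
Pr6-within = mk⇔ [ (λ (_ , i≢i) → ⊥-elim (i≢i refl)) , proj₂ ]′ (λ σ≢τ → inj₂ (refl , σ≢τ))

Pr6-between : ∀ {i j σ τ} → i ≢ j → Pr6 (i , σ) (j , τ) ⇔ σ ≡ τ
Pr6-between i≢j =
  mk⇔ [ proj₁ , (λ (i≡j , _) → ⊥-elim (i≢j i≡j)) ]′ (λ σ≡τ → inj₁ (σ≡τ , i≢j))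

_≟₆_ : DecidableEquality Six
_≟₆_ = ≡-dec _≟_ _≟_

all-Six? : {P : Six → Set} → (∀ s → Dec (P s)) → Dec (∀ s → P s)
all-Six? P? = map′ (λ h (i , σ) → h i σ) (λ h i σ → h (i , σ)) (all? λ i → all? λ σ → P? (i , σ))

Pr6? : ∀ s t → Dec (Pr6 s t)
Pr6? (i , σ) (j , τ) = ((σ ≟ τ) ×-dec ¬? (i ≟ j)) ⊎-dec ((i ≟ j) ×-dec ¬? (σ ≟ τ))

K33? : ∀ s t → Dec (K33 s t)
K33? (_ , σ) (_ , τ) = ¬? (σ ≟ τ)

ThreeK2? : ∀ s t → Dec (ThreeK2 s t)
ThreeK2? (i , σ) (j , τ) = (i ≟ j) ×-dec ¬? (σ ≟ τ)

M6? : ∀ i j → Dec (M6 i j)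
M6? i j =
  (toℕ j ℕ.≟ (toℕ i + 1) % 6) ⊎-dec (toℕ i ℕ.≟ (toℕ j + 1) % 6) ⊎-dec (toℕ j ℕ.≟ (toℕ i + 3) % 6)

singletonCoalition? : {X : Rel Six} → (∀ s t → Dec (X s t)) → ∀ s t → Dec (SingletonCoalition X s t)
singletonCoalition? {X} X? s t =
  X? s t ×-dec all-Six? (λ q → closed? s q ⊎-dec closed? t q)
         ×-dec ¬? (all-Six? (closed? s)) ×-dec ¬? (all-Six? (closed? t))
  where
  closed? : ∀ w q → Dec (ClosedNeighbourhood X w q)
  closed? w q = (q ≟₆ w) ⊎-dec X? q w

equal-decisions : {P Q : Set} (P? : Dec P) (Q? : Dec Q) → does P? ≡ does Q? → P ⇔ Q
equal-decisions (yes p) (yes q) _ = mk⇔ (λ _ → q) (λ _ → p)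
equal-decisions (no ¬p) (no ¬q) _ = mk⇔ (⊥-elim ∘ ¬p) (⊥-elim ∘ ¬q)

agree-on-Six? : {P Q : Rel Six} (P? : ∀ s t → Dec (P s t)) (Q? : ∀ s t → Dec (Q s t)) →
                Dec (∀ s t → does (P? s t) ≡ does (Q? s t))
agree-on-Six? P? Q? = all-Six? λ s → all-Six? λ t → does (P? s t) Bool.≟ does (Q? s t)

-- In a cubic graph on six vertices, N[w] ∪ N[w'] is everything iff w and w' have no common
-- neighbour, and no single N[w] is.
Pr6-singleton-coalitions : ∀ s t → SingletonCoalition Pr6 s t ⇔ ThreeK2 s t
Pr6-singleton-coalitions s t = equal-decisions (singletonCoalition? Pr6? s t) (ThreeK2? s t)
  (from-yes (agree-on-Six? (singletonCoalition? Pr6?) ThreeK2?) s t)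

K33-singleton-coalitions : ∀ s t → SingletonCoalition K33 s t ⇔ K33 s t
K33-singleton-coalitions s t = equal-decisions (singletonCoalition? K33? s t) (K33? s t)
  (from-yes (agree-on-Six? (singletonCoalition? K33?) K33?) s t)

-- remQuot 2 sends i to (i / 2 , i mod 2), and M6 joins exactly the vertices of different parity.
M6≅K33 : Iso M6 K33
M6≅K33 = record
  { to = remQuot {3} 2 ; from = uncurry combine
  ; from-to = combine-remQuot {3} 2 ; to-from = uncurry remQuot-combine
  ; adj⇔ = λ i j →
      equal-decisions (M6? i j) (K33? (remQuot 2 i) (remQuot 2 j)) (from-yes adjacency-agrees? i j) }
  where
  adjacency-agrees? : Dec (∀ i j → does (M6? i j) ≡ does (K33? (remQuot {3} 2 i) (remQuot {3} 2 j)))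
  adjacency-agrees? = all? λ i → all? λ j → does (M6? i j) Bool.≟ does (K33? (remQuot 2 i) (remQuot 2 j))

-- Disjoint connected dominating sets in a subcubic graph

record DisjointCDSFamily {n : ℕ} (E : Rel (Fin n)) (m : ℕ) : Set₁ where
  field
    D        : Fin m → Subset (Fin n)
    D?       : ∀ i v → Dec (D i v)
    disjoint : ∀ {i j v} → D i v → D j v → i ≡ j
    cds      : ∀ i → ConnectedDominating E (D i)
    x y      : Fin m → Fin n
    x∈D      : ∀ i → D i (x i)
    y∈D      : ∀ i → D i (y i)
    x≢y      : ∀ i → x i ≢ y i

  members-distinct : ∀ {i j v w} → D i v → D j w → i ≢ j → v ≢ w
  members-distinct Dv Dw i≢j refl = i≢j (disjoint Dv Dw)

  neighbour-in-other : ∀ {i j u} → D i u → j ≢ i → NeighbourIn E (D j) u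
  neighbour-in-other {j = j} Du j≢i = proj₁ (cds j) _ (λ Dju → j≢i (disjoint Dju Du))

  first-step : ∀ i → NeighbourIn E (D i) (x i)
  first-step i = walk-leaves (proj₂ (cds i) _ _ (x∈D i) (y∈D i)) (x≢y i)

module _ {n : ℕ} {E : Rel (Fin n)} (maxDeg : MaxDeg≤3 E) {m : ℕ} (F : DisjointCDSFamily E m) where
  open DisjointCDSFamily F

  family-size≤3 : Fin m → m ≤ 3
  family-size≤3 i₀ =
    injective-neighbour-family≤3 {E = E} maxDeg (proj₁ ∘ neighbour) neighbour-injective (proj₂ ∘ proj₂ ∘ neighbour)
    where
    neighbour : ∀ i → NeighbourIn E (D i) (x i₀)
    neighbour i with i ≟ i₀
    ... | yes refl = first-step i
    ... | no i≢i₀ = neighbour-in-other (x∈D i₀) i≢i₀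
    neighbour-injective : Injective _≡_ _≡_ (proj₁ ∘ neighbour)
    neighbour-injective {i} {j} wᵢ≡wⱼ =
      disjoint (proj₁ (proj₂ (neighbour i))) (subst (D j) (sym wᵢ≡wⱼ) (proj₁ (proj₂ (neighbour j))))

module ThreeMembers {n : ℕ} {E : Rel (Fin n)} (sc : Subcubic E) (F : DisjointCDSFamily E 3) where
  open DisjointCDSFamily F public

  E-sym : ∀ {u v} → E u v → E v u
  E-sym = proj₁ (proj₁ sc) _ _

  E-irrefl : ∀ {v} → ¬ E v v
  E-irrefl = proj₂ (proj₁ sc) _

  maxDeg : MaxDeg≤3 E
  maxDeg = proj₂ (proj₂ sc)

  at-most-one-neighbour-in : ∀ {j u w w'} → (∀ k → k ≢ j → NeighbourIn E (D k) u) →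
                             D j w → D j w' → E u w → E u w' → w ≡ w'
  at-most-one-neighbour-in {j} {u} {w} {w'} others Dw Dw' uw uw' =
    equal (others k₀ k₀≢j) (others k₁ k₁≢j)
    where
    k₀ k₁ : Fin 3
    k₀ = punchIn j zero
    k₁ = punchIn j (suc zero)
    k₀≢j : k₀ ≢ j
    k₀≢j = punchInᵢ≢i j zero
    k₁≢j : k₁ ≢ j
    k₁≢j = punchInᵢ≢i j (suc zero)
    j-apart : ∀ {k v v'} → D j v → D k v' → k ≢ j → v ≢ v'
    j-apart Dv Dv' k≢j = members-distinct Dv Dv' (k≢j ∘ sym)
    equal : NeighbourIn E (D k₀) u → NeighbourIn E (D k₁) u → w ≡ w'
    equal (a , Da , ua) (b , Db , ub) with w ≟ w'
    ... | yes w≡w' = w≡w'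
    ... | no w≢w' = ⊥-elim (no-four-distinct-neighbours {E = E} maxDeg (w ∷ w' ∷ a ∷ b ∷ [])
                             ((w≢w' ∷ j-apart Dw Da k₀≢j ∷ j-apart Dw Db k₁≢j ∷ [])
                               ∷ (j-apart Dw' Da k₀≢j ∷ j-apart Dw' Db k₁≢j ∷ [])
                               ∷ (members-distinct Da Db (0≢1+n ∘ punchIn-injective j zero (suc zero)) ∷ [])
                               ∷ [] ∷ [])
                             (uw ∷ uw' ∷ ua ∷ ub ∷ []))

  neighbours-covered : ∀ {u v} → (∀ k → NeighbourIn E (D k) u) → E u v → ∃ λ k → D k v
  neighbours-covered {u} {v} neighbour uv with any? (λ k → D? k v)
  ... | yes covered = covered
  ... | no uncovered =
    ⊥-elim (no-four-distinct-neighbours {E = E} maxDeg (v ∷ w (# 0) ∷ w (# 1) ∷ w (# 2) ∷ [])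
             ((v≢w (# 0) ∷ v≢w (# 1) ∷ v≢w (# 2) ∷ [])
               ∷ (members-distinct (Dw (# 0)) (Dw (# 1)) (λ ()) ∷ members-distinct (Dw (# 0)) (Dw (# 2)) (λ ()) ∷ [])
               ∷ (members-distinct (Dw (# 1)) (Dw (# 2)) (λ ()) ∷ [])
               ∷ [] ∷ [])
             (uv ∷ uw (# 0) ∷ uw (# 1) ∷ uw (# 2) ∷ []))
    where
    w : Fin 3 → Fin n
    w k = proj₁ (neighbour k)
    Dw : ∀ k → D k (w k)
    Dw k = proj₁ (proj₂ (neighbour k))
    uw : ∀ k → E u (w k)
    uw k = proj₂ (proj₂ (neighbour k))
    v≢w : ∀ k → v ≢ w k
    v≢w k refl = uncovered (k , Dw k)

  induced-max-deg≤1 : ∀ i → InducedMaxDeg≤1 E (D i)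
  induced-max-deg≤1 i Du = at-most-one-neighbour-in (λ k k≢i → neighbour-in-other Du k≢i)

  private
    module Member (i : Fin 3) where
      z : Fin n
      z = proj₁ (first-step i)

      on-first-edge : ∀ {v} → D i v → v ≡ x i ⊎ v ≡ z
      on-first-edge = connected-set-is-edge E-sym (induced-max-deg≤1 i) (x∈D i) (proj₁ (proj₂ (first-step i)))
                        (proj₂ (proj₂ (first-step i))) (proj₂ (cds i))

      y≡z : y i ≡ z
      y≡z with on-first-edge (y∈D i)
      ... | inj₁ y≡x = ⊥-elim (x≢y i (sym y≡x))
      ... | inj₂ y≡z = y≡z

  ends-adjacent : ∀ i → E (x i) (y i)
  ends-adjacent i = subst (E (x i)) (sym y≡z) (proj₂ (proj₂ (first-step i)))
    where open Member i

  member-is-end : ∀ {i v} → D i v → v ≡ x i ⊎ v ≡ y i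
  member-is-end {i} Dv = Sum.map₂ (λ v≡z → trans v≡z (sym y≡z)) (on-first-edge Dv)
    where open Member i

  neighbour-in-every : ∀ {i u} → D i u → ∀ j → NeighbourIn E (D j) u
  neighbour-in-every {i} Du j with j ≟ i
  ... | no j≢i = neighbour-in-other Du j≢i
  ... | yes refl with member-is-end Du
  ...   | inj₁ refl = y i , y∈D i , ends-adjacent i
  ...   | inj₂ refl = x i , x∈D i , E-sym (ends-adjacent i)

  unique-neighbour-in : ∀ {i j u w w'} → D i u → D j w → D j w' → E u w → E u w' → w ≡ w'
  unique-neighbour-in Du = at-most-one-neighbour-in (λ k _ → neighbour-in-every Du k)

  covered : ∀ v → ∃ λ i → D i v
  covered v with D? (# 0) v
  ... | yes Dv = # 0 , Dv
  ... | no ¬Dv with proj₁ (cds (# 0)) v ¬Dv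
  ...   | u , Du , vu = neighbours-covered (neighbour-in-every Du) (E-sym vu)

  record Ends (i : Fin 3) : Set where
    field
      v₀ v₁      : Fin n
      v₀∈D       : D i v₀
      v₁∈D       : D i v₁
      adjacent   : E v₀ v₁
      exhaustive : ∀ {v} → D i v → v ≡ v₀ ⊎ v ≡ v₁

    end : Fin 2 → Fin n
    end zero = v₀
    end (suc zero) = v₁

    end∈D : ∀ σ → D i (end σ)
    end∈D zero = v₀∈D
    end∈D (suc zero) = v₁∈D

    end-injective : Injective _≡_ _≡_ end
    end-injective {zero} {zero} _ = refl
    end-injective {zero} {suc zero} v₀≡v₁ = ⊥-elim (E-irrefl (subst (E v₀) (sym v₀≡v₁) adjacent))
    end-injective {suc zero} {zero} v₁≡v₀ = ⊥-elim (E-irrefl (subst (E v₀) v₁≡v₀ adjacent))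
    end-injective {suc zero} {suc zero} _ = refl

    labelled : ∀ {v} → D i v → ∃ λ σ → end σ ≡ v
    labelled Dv with exhaustive Dv
    ... | inj₁ v≡v₀ = zero , sym v≡v₀
    ... | inj₂ v≡v₁ = suc zero , sym v≡v₁

  canonical-ends : ∀ i → Ends i
  canonical-ends i = record
    { v₀ = x i ; v₁ = y i ; v₀∈D = x∈D i ; v₁∈D = y∈D i
    ; adjacent = ends-adjacent i ; exhaustive = member-is-end }

  reversed : ∀ {i} → Ends i → Ends i
  reversed e = record
    { v₀ = v₁ ; v₁ = v₀ ; v₀∈D = v₁∈D ; v₁∈D = v₀∈D
    ; adjacent = E-sym adjacent ; exhaustive = Sum.swap ∘ exhaustive }
    where open Ends e

  ends-starting-at : ∀ {i w} → D i w → Σ (Ends i) λ e → Ends.v₀ e ≡ w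
  ends-starting-at {i} Dw with member-is-end Dw
  ... | inj₁ refl = canonical-ends i , refl
  ... | inj₂ refl = reversed (canonical-ends i) , refl

  Labelling : Set
  Labelling = ∀ i → Ends i

  module Labelled (ℓ : Labelling) where

    vtx : Six → Fin n
    vtx (i , σ) = Ends.end (ℓ i) σ

    vtx∈D : ∀ i σ → D i (vtx (i , σ))
    vtx∈D i = Ends.end∈D (ℓ i)

    vtx-injective : Injective _≡_ _≡_ vtx
    vtx-injective {i , σ} {j , τ} eq with disjoint (vtx∈D i σ) (subst (D j) (sym eq) (vtx∈D j τ))
    ... | refl = cong (i ,_) (Ends.end-injective (ℓ i) eq)

    vtx-surjective : ∀ v → ∃ λ s → vtx s ≡ v
    vtx-surjective v = let (i , Dv) = covered v ; (σ , eq) = Ends.labelled (ℓ i) Dv in (i , σ) , eq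

    Block : Fin 3 → Fin 3 → Fin 2 → Fin 2 → Set
    Block i j σ τ = E (vtx (i , σ)) (vtx (j , τ))

    block-total : ∀ i j σ → ∃ (Block i j σ)
    block-total i j σ =
      let (w , Dw , uw) = neighbour-in-every (vtx∈D i σ) j ; (τ , vτ≡w) = Ends.labelled (ℓ j) Dw
      in τ , subst (E (vtx (i , σ))) (sym vτ≡w) uw

    block-functional : ∀ i j σ τ τ' → Block i j σ τ → Block i j σ τ' → τ ≡ τ'
    block-functional i j σ τ τ' b b' =
      Ends.end-injective (ℓ j) (unique-neighbour-in (vtx∈D i σ) (vtx∈D j τ) (vtx∈D j τ') b b')

    block-injective : ∀ i j σ σ' τ → Block i j σ τ → Block i j σ' τ → σ ≡ σ'
    block-injective i j σ σ' τ b b' =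
      Ends.end-injective (ℓ i) (unique-neighbour-in (vtx∈D j τ) (vtx∈D i σ) (vtx∈D i σ') (E-sym b) (E-sym b'))

    straight-block : ∀ {i j} → Block i j zero zero → ∀ σ τ → Block i j σ τ ⇔ σ ≡ τ
    straight-block {i} {j} =
      PerfectMatching₂.straight (block-total i j) (block-functional i j) (block-injective i j)

    crossed-block : ∀ {i j} → Block i j zero (suc zero) → ∀ σ τ → Block i j σ τ ⇔ σ ≢ τ
    crossed-block {i} {j} =
      PerfectMatching₂.crossed (block-total i j) (block-functional i j) (block-injective i j)

    crossed-sym : ∀ {i j} → Block i j zero (suc zero) → Block j i zero (suc zero)
    crossed-sym c = E-sym (back (crossed-block c (suc zero) zero) (λ ()))

    -- Within one edge the block is crossed: the only neighbour of an end inside it is the other end.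
    prism-if-straight : Block (# 0) (# 1) zero zero → Block (# 0) (# 2) zero zero →
                        Block (# 1) (# 2) zero zero → ∀ s t → E (vtx s) (vtx t) ⇔ Pr6 s t
    prism-if-straight b₀₁ b₀₂ b₁₂ (i , σ) (j , τ) with i ≟ j
    ... | yes refl = ⇔-sym Pr6-within ⇔-∘ crossed-block (Ends.adjacent (ℓ i)) σ τ
    ... | no i≢j =
      ⇔-sym (Pr6-between i≢j) ⇔-∘ straight-block (off-diagonal-pairs E-sym b₀₁ b₀₂ b₁₂ i j i≢j) σ τ

    K33-if-crossed : Block (# 0) (# 1) zero (suc zero) → Block (# 0) (# 2) zero (suc zero) →
                     Block (# 1) (# 2) zero (suc zero) → ∀ s t → E (vtx s) (vtx t) ⇔ K33 s t
    K33-if-crossed c₀₁ c₀₂ c₁₂ (i , σ) (j , τ) with i ≟ j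
    ... | yes refl = crossed-block (Ends.adjacent (ℓ i)) σ τ
    ... | no i≢j = crossed-block (off-diagonal-pairs crossed-sym c₀₁ c₀₂ c₁₂ i j i≢j) σ τ

    iso : {X : Rel Six} → (∀ s t → E (vtx s) (vtx t) ⇔ X s t) → Iso X E
    iso E⇔X = record
      { to = vtx ; from = proj₁ ∘ vtx-surjective
      ; from-to = λ s → vtx-injective (proj₂ (vtx-surjective (vtx s)))
      ; to-from = proj₂ ∘ vtx-surjective
      ; adj⇔ = λ s t → ⇔-sym (E⇔X s t) }

  open Labelled using (vtx)

  towards-x₀ : ∀ j → Σ (Ends j) λ e → E (x (# 0)) (Ends.v₀ e)
  towards-x₀ j =
    let (w , Dw , x₀w) = neighbour-in-every (x∈D (# 0)) j ; (e , v₀≡w) = ends-starting-at Dw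
    in e , subst (E (x (# 0))) (sym v₀≡w) x₀w

  x₀∼v₀ : ∀ j → E (x (# 0)) (Ends.v₀ (proj₁ (towards-x₀ j)))
  x₀∼v₀ j = proj₂ (towards-x₀ j)

  straight-labelling : Labelling
  straight-labelling zero = canonical-ends (# 0)
  straight-labelling (suc j) = proj₁ (towards-x₀ (suc j))

  -- Reversing the second and third edge makes their blocks with the first crossed and leaves the
  -- block between them unchanged.
  twisted-labelling : Labelling
  twisted-labelling zero = canonical-ends (# 0)
  twisted-labelling (suc j) = reversed (straight-labelling (suc j))

  prism-or-K33 : Σ Labelling λ ℓ → (∀ s t → E (vtx ℓ s) (vtx ℓ t) ⇔ Pr6 s t)
                                 ⊎ (∀ s t → E (vtx ℓ s) (vtx ℓ t) ⇔ K33 s t)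
  prism-or-K33 with Labelled.block-total straight-labelling (# 1) (# 2) zero
  ... | zero , b₁₂ = straight-labelling ,
        inj₁ (Labelled.prism-if-straight straight-labelling (x₀∼v₀ (# 1)) (x₀∼v₀ (# 2)) b₁₂)
  ... | suc zero , c₁₂ = twisted-labelling ,
        inj₂ (Labelled.K33-if-crossed twisted-labelling (x₀∼v₀ (# 1)) (x₀∼v₀ (# 2))
                (back (Labelled.crossed-block straight-labelling {# 1} {# 2} c₁₂ (suc zero) zero) (λ ())))

-- The coalition graph

module CoalitionGraph {n k : ℕ} (E : Rel (Fin n)) (p : Fin n → Fin k) (sc : Subcubic E)
                      (ccp : IsConnCoalitionPartition E p) where

  representative : Fin k → Fin n
  representative c = proj₁ (proj₁ ccp c)

  representative-class : ∀ c → p (representative c) ≡ c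
  representative-class c = proj₂ (proj₁ ccp c)

  module _ {m : ℕ} (a b : Fin m → Fin k) (coalition : ∀ i → CCG E p (a i) (b i))
           (injective : Injective _≡_ _≡_ [ a , b ]′) where

    D : Fin m → Subset (Fin n)
    D i = Class p (a i) ∪ Class p (b i)

    classes-disjoint : ∀ {i j v} → D i v → D j v → i ≡ j
    classes-disjoint (inj₁ v∈aᵢ) (inj₁ v∈aⱼ) =
      inj₁-injective (injective {inj₁ _} {inj₁ _} (trans (sym v∈aᵢ) v∈aⱼ))
    classes-disjoint (inj₁ v∈aᵢ) (inj₂ v∈bⱼ) with () ← injective {inj₁ _} {inj₂ _} (trans (sym v∈aᵢ) v∈bⱼ)
    classes-disjoint (inj₂ v∈bᵢ) (inj₁ v∈aⱼ) with () ← injective {inj₂ _} {inj₁ _} (trans (sym v∈bᵢ) v∈aⱼ)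
    classes-disjoint (inj₂ v∈bᵢ) (inj₂ v∈bⱼ) =
      inj₂-injective (injective {inj₂ _} {inj₂ _} (trans (sym v∈bᵢ) v∈bⱼ))

    matched-classes-differ : ∀ i → p (representative (a i)) ≢ p (representative (b i))
    matched-classes-differ i eq with () ← injective {inj₁ i} {inj₂ i}
      (trans (sym (representative-class (a i))) (trans eq (representative-class (b i))))

    family : DisjointCDSFamily E m
    family = record
      { D = D
      ; D? = λ i v → (p v ≟ a i) ⊎-dec (p v ≟ b i)
      ; disjoint = classes-disjoint
      ; cds = λ i → proj₂ (proj₂ (proj₂ (coalition i)))
      ; x = representative ∘ a
      ; y = representative ∘ b
      ; x∈D = λ i → inj₁ (representative-class (a i))
      ; y∈D = λ i → inj₂ (representative-class (b i))
      ; x≢y = λ i → matched-classes-differ i ∘ cong p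
      }

  matching-number≤3 : MatchingNumber≤ (CCG E p) 3
  matching-number≤3 zero _ = z≤n
  matching-number≤3 (suc m) (a , b , coalition , injective) =
    family-size≤3 {E = E} (proj₂ (proj₂ sc)) (family a b coalition injective) zero

  module _ (a b : Fin 3 → Fin k) (coalition : ∀ i → CCG E p (a i) (b i))
           (injective : Injective _≡_ _≡_ [ a , b ]′) where

    open ThreeMembers sc (family a b coalition injective)

    p-injective : Injective _≡_ _≡_ p
    p-injective {u} {v} pu≡pv with covered v
    ... | i , Dv with member-is-end (Sum.map (trans pu≡pv) (trans pu≡pv) Dv) | member-is-end Dv
    ...   | inj₁ refl | inj₁ refl = refl
    ...   | inj₁ refl | inj₂ refl = ⊥-elim (matched-classes-differ a b coalition injective i pu≡pv)
    ...   | inj₂ refl | inj₁ refl = ⊥-elim (matched-classes-differ a b coalition injective i (sym pu≡pv))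
    ...   | inj₂ refl | inj₂ refl = refl

    class-of : ∀ v u → Class p (p v) u ⇔ u ≡ v
    class-of v u = mk⇔ p-injective (cong p)

    SingletonCoalition≅CCG : Iso (SingletonCoalition E) (CCG E p)
    SingletonCoalition≅CCG = record
      { to = p ; from = representative
      ; from-to = λ v → p-injective (representative-class (p v))
      ; to-from = representative-class
      ; adj⇔ = λ u v → ⇔-sym (singleton-coalition (proj₁ sc) _≟_ (class-of u) (class-of v)) }

    coalition-graph-iso : {X Y : Rel Six} → Iso X E → (∀ s t → SingletonCoalition X s t ⇔ Y s t) →
                          Iso Y (CCG E p)
    coalition-graph-iso X≅E coalitions⇔Y =
      Iso-trans (Iso-reflexive (λ s t → ⇔-sym (coalitions⇔Y s t)))
        (Iso-trans (Iso-SingletonCoalition X≅E) SingletonCoalition≅CCG)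

    prism-case : Iso Pr6 E → Iso E Pr6 × Iso (CCG E p) ThreeK2
    prism-case Pr6≅E = Iso-sym Pr6≅E , Iso-sym (coalition-graph-iso Pr6≅E Pr6-singleton-coalitions)

    K33-case : Iso K33 E → Iso E (CCG E p) × Iso (CCG E p) M6 × Iso M6 K33 × Iso E M6
    K33-case K33≅E =
      Iso-trans E≅K33 K33≅CCG , Iso-trans (Iso-sym K33≅CCG) K33≅M6 , M6≅K33 , Iso-trans E≅K33 K33≅M6
      where
      E≅K33 : Iso E K33
      E≅K33 = Iso-sym K33≅E
      K33≅CCG : Iso K33 (CCG E p)
      K33≅CCG = coalition-graph-iso K33≅E K33-singleton-coalitions
      K33≅M6 : Iso K33 M6
      K33≅M6 = Iso-sym M6≅K33

    classification : (Iso E (CCG E p) × Iso (CCG E p) M6 × Iso M6 K33 × Iso E M6)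
                     ⊎ (Iso E Pr6 × Iso (CCG E p) ThreeK2)
    classification with prism-or-K33
    ... | ℓ , inj₁ prism = inj₂ (prism-case (Labelled.iso ℓ prism))
    ... | ℓ , inj₂ bipartite = inj₁ (K33-case (Labelled.iso ℓ bipartite))

lemma2 : ∀ {n k : ℕ} (E : Rel (Fin n)) (p : Fin n → Fin k) →
    Subcubic E → IsConnCoalitionPartition E p →
    MatchingNumber≤ (CCG E p) 3 ×
    (MatchingNumber≡ (CCG E p) 3 →
      (Iso E (CCG E p) × Iso (CCG E p) M6 × Iso M6 K33 × Iso E M6)
      ⊎ (Iso E Pr6 × Iso (CCG E p) ThreeK2))
lemma2 E p sc ccp =
  matching-number≤3 , λ ((a , b , coalition , injective) , _) → classification a b coalition injective
  where open CoalitionGraph E p sc ccp
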